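{- Let $D$ be the derivation on Laurent polynomials in $a,b,x,y,z$ determined by $$D(a)=az,\quad D(b)=xy,\quad D(x)=xy,\quad D(y)=xy,\quad D(z)=xy$$ (extended by linearity and the Leibniz rule), and for a Laurent polynomial $w$ let $\mathrm{Gen}(w,t)=\sum_{n\ge0}D^n(w)\frac{t^n}{n!}$. Then, as formal power series in $t$, $$\mathrm{Gen}(ab,t)=\frac{a(y-x)e^{zt}}{ye^{xt}-xe^{yt}}\left(\frac{x-y}{1-yx^{ -1}e^{(x-y)t}}-x+b\right).$$
   Context: $D^0(w)=w$. Here $D$ is the formal derivative associated with the grammar $\{a\to az,\ b\to xy,\ x\to xy,\ y\to xy,\ z\to xy\}$. -}

module Defs where

open import Data.Nat as ℕ using (ℕ; zero; suc)
open import Data.Nat.Combinatorics using (_C_)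
open import Data.Integer as ℤ using (ℤ; +_; -[1+_])
open import Data.Vec as Vec using (Vec; []; _∷_; zipWith; replicate)
open import Data.Vec.Properties using (≡-dec)
open import Data.List as List using (List; []; _∷_; _++_; map; concatMap; foldr; upTo)
open import Data.Product using (_×_; _,_)
open import Relation.Nullary using (does)
open import Data.Bool using (if_then_else_)
open import Relation.Binary.PropositionalEquality using (_≡_)

-- A monomial a^i b^j x^k y^l z^m is its exponent vector (i,j,k,l,m) ∈ ℤ⁵.
-- A Laurent polynomial is a finite formal sum (list) of terms c·monomial;
-- two Laurent polynomials are equal iff all their coefficients agree.

Mono : Set
Mono = Vec ℤ 5

Term : Set
Term = ℤ × Mono

LPoly : Set
LPoly = List Term

coeff : LPoly → Mono → ℤ
coeff p m = foldr step (+ 0) p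
  where
  step : Term → ℤ → ℤ
  step (c , e) acc = if does (≡-dec ℤ._≟_ e m) then c ℤ.+ acc else acc

_≈ₚ_ : LPoly → LPoly → Set
p ≈ₚ q = ∀ m → coeff p m ≡ coeff q m

infixl 6 _+ₚ_ _-ₚ_
infixl 7 _*ₚ_

0ₚ : LPoly
0ₚ = []

1ₚ : LPoly
1ₚ = (+ 1 , replicate 5 (+ 0)) ∷ []

_+ₚ_ : LPoly → LPoly → LPoly
p +ₚ q = p ++ q

scaleₚ : ℤ → LPoly → LPoly
scaleₚ k p = map (λ { (c , e) → (k ℤ.* c , e) }) p

negₚ : LPoly → LPoly
negₚ = scaleₚ (ℤ.- (+ 1))

_-ₚ_ : LPoly → LPoly → LPoly
p -ₚ q = p +ₚ negₚ q

_*ₚ_ : LPoly → LPoly → LPoly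
p *ₚ q = concatMap (λ { (c , e) → map (λ { (d , f) → (c ℤ.* d , zipWith ℤ._+_ e f) }) q }) p

_^ₚ_ : LPoly → ℕ → LPoly
p ^ₚ zero = 1ₚ
p ^ₚ suc n = p *ₚ (p ^ₚ n)

mono : ℤ → ℤ → ℤ → ℤ → ℤ → LPoly
mono i j k l m = (+ 1 , i ∷ j ∷ k ∷ l ∷ m ∷ []) ∷ []

va vb vx vy vz x⁻¹ : LPoly
va  = mono (+ 1) (+ 0) (+ 0) (+ 0) (+ 0)
vb  = mono (+ 0) (+ 1) (+ 0) (+ 0) (+ 0)
vx  = mono (+ 0) (+ 0) (+ 1) (+ 0) (+ 0)
vy  = mono (+ 0) (+ 0) (+ 0) (+ 1) (+ 0)
vz  = mono (+ 0) (+ 0) (+ 0) (+ 0) (+ 1)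
x⁻¹ = mono (+ 0) (+ 0) -[1+ 0 ] (+ 0) (+ 0)

-- On a monomial
--   D(a^i b^j x^k y^l z^m) = i·a^i b^j x^k y^l z^(m+1)        (a ↦ az)
--                          + j·a^i b^(j-1) x^(k+1) y^(l+1) z^m (b ↦ xy)
--                          + k·a^i b^j x^k y^(l+1) z^m         (x ↦ xy)
--                          + l·a^i b^j x^(k+1) y^l z^m         (y ↦ xy)
--                          + m·a^i b^j x^(k+1) y^(l+1) z^(m-1) (z ↦ xy)

shift : Mono → ℤ → ℤ → ℤ → ℤ → ℤ → Mono
shift e di dj dk dl dm = zipWith ℤ._+_ e (di ∷ dj ∷ dk ∷ dl ∷ dm ∷ [])

DTerm : Term → LPoly
DTerm (c , e@(i ∷ j ∷ k ∷ l ∷ m ∷ [])) =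
    (c ℤ.* i , shift e (+ 0) (+ 0) (+ 0) (+ 0) (+ 1))
  ∷ (c ℤ.* j , shift e (+ 0) -[1+ 0 ] (+ 1) (+ 1) (+ 0))
  ∷ (c ℤ.* k , shift e (+ 0) (+ 0) (+ 0) (+ 1) (+ 0))
  ∷ (c ℤ.* l , shift e (+ 0) (+ 0) (+ 1) (+ 0) (+ 0))
  ∷ (c ℤ.* m , shift e (+ 0) (+ 0) (+ 1) (+ 1) -[1+ 0 ])
  ∷ []

D : LPoly → LPoly
D = concatMap DTerm

D^ : ℕ → LPoly → LPoly
D^ zero w = w
D^ (suc n) w = D (D^ n w)

-- Formal power series in t over the Laurent polynomials, in exponential
-- (divided-power) coordinates: f : ℕ → LPoly represents Σₙ f n · tⁿ/n!.

Series : Set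
Series = ℕ → LPoly

infix 4 _≈ₛ_ _≈ₚ_
_≈ₛ_ : Series → Series → Set
f ≈ₛ g = ∀ n → f n ≈ₚ g n

infixl 6 _⊕_ _⊖_
infixl 7 _⊛_

_⊕_ : Series → Series → Series
(f ⊕ g) n = f n +ₚ g n

_⊖_ : Series → Series → Series
(f ⊖ g) n = f n -ₚ g n

_⊛_ : Series → Series → Series
(f ⊛ g) n = concatMap (λ k → scaleₚ (+ (n C k)) (f k *ₚ g (n ℕ.∸ k))) (upTo (suc n))

const : LPoly → Series
const p zero = p
const p (suc n) = 0ₚ

expS : LPoly → Series
expS u n = u ^ₚ n

Gen : LPoly → Series
Gen w n = D^ n w

module Submission where

open import Defs

open import Algebra.Solver.Ring.AlmostCommutativeRing
  using (AlmostCommutativeRing; _-Raw-AlmostCommutative⟶_)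
open import Data.Bool using (Bool; true; false; if_then_else_)
open import Data.Fin using (Fin; #_)
open import Data.Integer as ℤ using (ℤ; +_; -[1+_]; _+_; _*_; -_)
import Data.Integer.Properties as ℤP
open import Data.Integer.Tactic.RingSolver using (solve-∀)
open import Data.List using (List; []; _∷_; _++_; concatMap; applyUpTo)
open import Data.List.Properties using (++-assoc; ++-identityʳ)
open import Data.Maybe using (Maybe; just; nothing)
open import Data.Nat as ℕ using (ℕ; zero; suc; _∸_; s≤s)
open import Data.Nat.Combinatorics using (_C_; nCk+nC[k+1]≡[n+1]C[k+1]; k>n⇒nCk≡0)
import Data.Nat.Properties as ℕP
open import Data.Product using (_×_; _,_)
open import Data.Vec using (Vec; []; _∷_; zipWith; replicate; lookup)
open import Data.Vec.Properties
  using (≡-dec; lookup-zipWith; zipWith-comm; zipWith-assoc; zipWith-identityˡ)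
open import Relation.Binary.Bundles using (Setoid)
open import Relation.Binary.PropositionalEquality
open import Relation.Nullary using (does; yes; no)
import Relation.Binary.Reasoning.Setoid as SetoidReasoning
import Algebra.Structures.Biased as Biased

-- The exponential series over the Laurent polynomials form a commutative ring on which
-- ∂ (shift of coefficients) is a derivation, and Gen is a ring map intertwining D with ∂.
-- Hence X = Gen(x) satisfies the Riccati equation X' = X(X + y − x), A = Gen(a) satisfies
-- A' = A(X + z − x), and Gen(ab) = A(X + b − x) because D(b − x) = 0.  Writing
-- R = 1 − (y/x)e^{(x−y)t} and T = ye^{xt} − xe^{yt} = −xe^{yt}R, one checks that X R − (x − y)
-- and A T − a(y − x)e^{zt} both satisfy homogeneous linear equations W' = W K and vanish at
-- t = 0, so they vanish; then Gen(ab) T R = (A T)(X R + (b − x) R) is the right-hand side.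

-- Laurent polynomials as functionals on weights

infixl 6 _⊞_
_⊞_ : Mono → Mono → Mono
_⊞_ = zipWith ℤ._+_

0ᵐ : Mono
0ᵐ = replicate 5 (+ 0)

⊞-comm : ∀ e f → e ⊞ f ≡ f ⊞ e
⊞-comm = zipWith-comm ℤP.+-comm

⊞-assoc : ∀ e f g → (e ⊞ f) ⊞ g ≡ e ⊞ (f ⊞ g)
⊞-assoc = zipWith-assoc ℤP.+-assoc

⊞-identityˡ : ∀ e → 0ᵐ ⊞ e ≡ e
⊞-identityˡ = zipWith-identityˡ ℤP.+-identityˡ

-- Coefficients are the values on indicator weights (≅⇒≈ₚ), so equality of these functionals
-- implies ≈ₚ and reduces every ring law for LPoly to an identity in ℤ.
⟪_⟫ : LPoly → (Mono → ℤ) → ℤ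
⟪ [] ⟫ φ = + 0
⟪ (c , e) ∷ p ⟫ φ = c * φ e + ⟪ p ⟫ φ

infix 4 _≅_
record _≅_ (p q : LPoly) : Set where
  constructor ≅-intro
  infixl 20 _on_
  field _on_ : ∀ φ → ⟪ p ⟫ φ ≡ ⟪ q ⟫ φ
open _≅_ public

≅-refl : ∀ {p} → p ≅ p
≅-refl = ≅-intro λ _ → refl

≅-reflexive : ∀ {p q} → p ≡ q → p ≅ q
≅-reflexive refl = ≅-refl

≅-sym : ∀ {p q} → p ≅ q → q ≅ p
≅-sym e = ≅-intro λ φ → sym (e on φ)

≅-trans : ∀ {p q r} → p ≅ q → q ≅ r → p ≅ r
≅-trans e e′ = ≅-intro λ φ → trans (e on φ) (e′ on φ)

≅-setoid : Setoid _ _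
≅-setoid = record
  { Carrier = LPoly ; _≈_ = _≅_
  ; isEquivalence = record { refl = ≅-refl ; sym = ≅-sym ; trans = ≅-trans } }

module ≅-Reasoning = SetoidReasoning ≅-setoid

⟪⟫-cong : ∀ p {φ ψ} → (∀ e → φ e ≡ ψ e) → ⟪ p ⟫ φ ≡ ⟪ p ⟫ ψ
⟪⟫-cong [] φ≗ψ = refl
⟪⟫-cong ((c , e) ∷ p) φ≗ψ = cong₂ (λ u v → c * u + v) (φ≗ψ e) (⟪⟫-cong p φ≗ψ)

⟪⟫-++ : ∀ p q φ → ⟪ p ++ q ⟫ φ ≡ ⟪ p ⟫ φ + ⟪ q ⟫ φ
⟪⟫-++ [] q φ = sym (ℤP.+-identityˡ _)
⟪⟫-++ ((c , e) ∷ p) q φ =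
  trans (cong (_+_ (c * φ e)) (⟪⟫-++ p q φ)) (sym (ℤP.+-assoc (c * φ e) _ _))

⟪⟫-scaleₚ : ∀ k p φ → ⟪ scaleₚ k p ⟫ φ ≡ k * ⟪ p ⟫ φ
⟪⟫-scaleₚ k [] φ = sym (ℤP.*-zeroʳ k)
⟪⟫-scaleₚ k ((c , e) ∷ p) φ =
  trans (cong (_+_ ((k * c) * φ e)) (⟪⟫-scaleₚ k p φ)) (factor k c (φ e) _)
  where
  factor : ∀ k c a r → (k * c) * a + k * r ≡ k * (c * a + r)
  factor = solve-∀

⟪⟫-zero : ∀ p → ⟪ p ⟫ (λ _ → + 0) ≡ + 0
⟪⟫-zero [] = refl
⟪⟫-zero ((c , e) ∷ p) = cong₂ _+_ (ℤP.*-zeroʳ c) (⟪⟫-zero p)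

⟪⟫-+ : ∀ p φ ψ → ⟪ p ⟫ (λ e → φ e + ψ e) ≡ ⟪ p ⟫ φ + ⟪ p ⟫ ψ
⟪⟫-+ [] φ ψ = refl
⟪⟫-+ ((c , e) ∷ p) φ ψ =
  trans (cong (_+_ (c * (φ e + ψ e))) (⟪⟫-+ p φ ψ)) (regroup c (φ e) (ψ e) _ _)
  where
  regroup : ∀ c a b r s → c * (a + b) + (r + s) ≡ (c * a + r) + (c * b + s)
  regroup = solve-∀

⟪⟫-*ˡ : ∀ p k φ → ⟪ p ⟫ (λ e → k * φ e) ≡ k * ⟪ p ⟫ φ
⟪⟫-*ˡ [] k φ = sym (ℤP.*-zeroʳ k)
⟪⟫-*ˡ ((c , e) ∷ p) k φ =
  trans (cong (_+_ (c * (k * φ e))) (⟪⟫-*ˡ p k φ)) (factor c k (φ e) _)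
  where
  factor : ∀ c k a r → c * (k * a) + k * r ≡ k * (c * a + r)
  factor = solve-∀

⟪⟫-*ₚ : ∀ p q φ → ⟪ p *ₚ q ⟫ φ ≡ ⟪ p ⟫ (λ e → ⟪ q ⟫ (λ f → φ (e ⊞ f)))
⟪⟫-*ₚ [] q φ = refl
⟪⟫-*ₚ ((c , e) ∷ p) q φ = begin
    ⟪ ((c , e) ∷ p) *ₚ q ⟫ φ
  ≡⟨ cong (λ r → ⟪ r ⟫ φ) split ⟩
    ⟪ ((c , e) ∷ []) *ₚ q ++ p *ₚ q ⟫ φ
  ≡⟨ ⟪⟫-++ (((c , e) ∷ []) *ₚ q) (p *ₚ q) φ ⟩
    ⟪ ((c , e) ∷ []) *ₚ q ⟫ φ + ⟪ p *ₚ q ⟫ φ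
  ≡⟨ cong₂ _+_ (⟪⟫-monomial-*ₚ q) (⟪⟫-*ₚ p q φ) ⟩
    c * ⟪ q ⟫ (λ f → φ (e ⊞ f)) + ⟪ p ⟫ (λ e′ → ⟪ q ⟫ (λ f → φ (e′ ⊞ f)))
  ∎
  where
  open ≡-Reasoning
  split : ((c , e) ∷ p) *ₚ q ≡ ((c , e) ∷ []) *ₚ q ++ p *ₚ q
  split = cong (_++ p *ₚ q) (sym (++-identityʳ _))
  factor : ∀ c d a r → (c * d) * a + c * r ≡ c * (d * a + r)
  factor = solve-∀
  ⟪⟫-monomial-*ₚ : ∀ q → ⟪ ((c , e) ∷ []) *ₚ q ⟫ φ ≡ c * ⟪ q ⟫ (λ f → φ (e ⊞ f))
  ⟪⟫-monomial-*ₚ [] = sym (ℤP.*-zeroʳ c)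
  ⟪⟫-monomial-*ₚ ((d , f) ∷ q) =
    trans (cong (_+_ ((c * d) * φ (e ⊞ f))) (⟪⟫-monomial-*ₚ q)) (factor c d (φ (e ⊞ f)) _)

⟪⟫-swap : ∀ p q (ψ : Mono → Mono → ℤ) →
          ⟪ p ⟫ (λ e → ⟪ q ⟫ (ψ e)) ≡ ⟪ q ⟫ (λ f → ⟪ p ⟫ (λ e → ψ e f))
⟪⟫-swap [] q ψ = sym (⟪⟫-zero q)
⟪⟫-swap ((c , e) ∷ p) q ψ = sym (begin
    ⟪ q ⟫ (λ f → c * ψ e f + ⟪ p ⟫ (λ e′ → ψ e′ f))
  ≡⟨ ⟪⟫-+ q _ _ ⟩
    ⟪ q ⟫ (λ f → c * ψ e f) + ⟪ q ⟫ (λ f → ⟪ p ⟫ (λ e′ → ψ e′ f))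
  ≡⟨ cong₂ _+_ (⟪⟫-*ˡ q c (ψ e)) (sym (⟪⟫-swap p q ψ)) ⟩
    c * ⟪ q ⟫ (ψ e) + ⟪ p ⟫ (λ e′ → ⟪ q ⟫ (ψ e′))
  ∎)
  where open ≡-Reasoning

++-cong : ∀ {p p′ q q′} → p ≅ p′ → q ≅ q′ → p ++ q ≅ p′ ++ q′
++-cong {p} {p′} {q} {q′} p≅p′ q≅q′ = ≅-intro λ φ →
  trans (⟪⟫-++ p q φ) (trans (cong₂ _+_ (p≅p′ on φ) (q≅q′ on φ)) (sym (⟪⟫-++ p′ q′ φ)))

++-comm : ∀ p q → p ++ q ≅ q ++ p
++-comm p q = ≅-intro λ φ →
  trans (⟪⟫-++ p q φ) (trans (ℤP.+-comm (⟪ p ⟫ φ) _) (sym (⟪⟫-++ q p φ)))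

+ₚ-minus : ∀ v w → v +ₚ (w -ₚ v) ≅ w
+ₚ-minus v w = ≅-intro λ φ → begin
    ⟪ v ++ (w ++ negₚ v) ⟫ φ
  ≡⟨ trans (⟪⟫-++ v _ φ) (cong (_+_ (⟪ v ⟫ φ)) (⟪⟫-++ w _ φ)) ⟩
    ⟪ v ⟫ φ + (⟪ w ⟫ φ + ⟪ negₚ v ⟫ φ)
  ≡⟨ cong (λ t → ⟪ v ⟫ φ + (⟪ w ⟫ φ + t)) (⟪⟫-scaleₚ (- + 1) v φ) ⟩
    ⟪ v ⟫ φ + (⟪ w ⟫ φ + - + 1 * ⟪ v ⟫ φ)
  ≡⟨ cancel (⟪ v ⟫ φ) (⟪ w ⟫ φ) ⟩
    ⟪ w ⟫ φ
  ∎
  where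
  open ≡-Reasoning
  cancel : ∀ a b → a + (b + - + 1 * a) ≡ b
  cancel = solve-∀

*ₚ-cong : ∀ {p p′ q q′} → p ≅ p′ → q ≅ q′ → p *ₚ q ≅ p′ *ₚ q′
*ₚ-cong {p} {p′} {q} {q′} p≅p′ q≅q′ = ≅-intro λ φ → begin
    ⟪ p *ₚ q ⟫ φ                              ≡⟨ ⟪⟫-*ₚ p q φ ⟩
    ⟪ p ⟫ (λ e → ⟪ q ⟫ (λ f → φ (e ⊞ f)))     ≡⟨ p≅p′ on _ ⟩
    ⟪ p′ ⟫ (λ e → ⟪ q ⟫ (λ f → φ (e ⊞ f)))    ≡⟨ ⟪⟫-cong p′ (λ e → q≅q′ on _) ⟩
    ⟪ p′ ⟫ (λ e → ⟪ q′ ⟫ (λ f → φ (e ⊞ f)))   ≡⟨ ⟪⟫-*ₚ p′ q′ φ ⟨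
    ⟪ p′ *ₚ q′ ⟫ φ                            ∎
  where open ≡-Reasoning

*ₚ-comm : ∀ p q → p *ₚ q ≅ q *ₚ p
*ₚ-comm p q = ≅-intro λ φ → begin
    ⟪ p *ₚ q ⟫ φ
  ≡⟨ ⟪⟫-*ₚ p q φ ⟩
    ⟪ p ⟫ (λ e → ⟪ q ⟫ (λ f → φ (e ⊞ f)))
  ≡⟨ ⟪⟫-swap p q (λ e f → φ (e ⊞ f)) ⟩
    ⟪ q ⟫ (λ f → ⟪ p ⟫ (λ e → φ (e ⊞ f)))
  ≡⟨ ⟪⟫-cong q (λ f → ⟪⟫-cong p (λ e → cong φ (⊞-comm e f))) ⟩
    ⟪ q ⟫ (λ f → ⟪ p ⟫ (λ e → φ (f ⊞ e)))
  ≡⟨ ⟪⟫-*ₚ q p φ ⟨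
    ⟪ q *ₚ p ⟫ φ
  ∎
  where open ≡-Reasoning

*ₚ-assoc : ∀ p q r → (p *ₚ q) *ₚ r ≅ p *ₚ (q *ₚ r)
*ₚ-assoc p q r = ≅-intro λ φ → begin
    ⟪ (p *ₚ q) *ₚ r ⟫ φ
  ≡⟨ trans (⟪⟫-*ₚ (p *ₚ q) r φ) (⟪⟫-*ₚ p q _) ⟩
    ⟪ p ⟫ (λ e → ⟪ q ⟫ (λ f → ⟪ r ⟫ (λ g → φ ((e ⊞ f) ⊞ g))))
  ≡⟨ ⟪⟫-cong p (λ e → ⟪⟫-cong q (λ f → ⟪⟫-cong r (λ g → cong φ (⊞-assoc e f g)))) ⟩
    ⟪ p ⟫ (λ e → ⟪ q ⟫ (λ f → ⟪ r ⟫ (λ g → φ (e ⊞ (f ⊞ g)))))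
  ≡⟨ ⟪⟫-cong p (λ e → ⟪⟫-*ₚ q r (λ h → φ (e ⊞ h))) ⟨
    ⟪ p ⟫ (λ e → ⟪ q *ₚ r ⟫ (λ h → φ (e ⊞ h)))
  ≡⟨ ⟪⟫-*ₚ p (q *ₚ r) φ ⟨
    ⟪ p *ₚ (q *ₚ r) ⟫ φ
  ∎
  where open ≡-Reasoning

*ₚ-distribʳ : ∀ p q r → (p ++ q) *ₚ r ≅ p *ₚ r ++ q *ₚ r
*ₚ-distribʳ p q r = ≅-intro λ φ → begin
    ⟪ (p ++ q) *ₚ r ⟫ φ                      ≡⟨ trans (⟪⟫-*ₚ (p ++ q) r φ) (⟪⟫-++ p q _) ⟩
    ⟪ p ⟫ (ψ φ) + ⟪ q ⟫ (ψ φ)                 ≡⟨ cong₂ _+_ (⟪⟫-*ₚ p r φ) (⟪⟫-*ₚ q r φ) ⟨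
    ⟪ p *ₚ r ⟫ φ + ⟪ q *ₚ r ⟫ φ               ≡⟨ ⟪⟫-++ (p *ₚ r) (q *ₚ r) φ ⟨
    ⟪ p *ₚ r ++ q *ₚ r ⟫ φ                   ∎
  where
  open ≡-Reasoning
  ψ : (Mono → ℤ) → Mono → ℤ
  ψ φ e = ⟪ r ⟫ (λ f → φ (e ⊞ f))

*ₚ-identityˡ : ∀ p → 1ₚ *ₚ p ≅ p
*ₚ-identityˡ p = ≅-intro λ φ →
  trans (⟪⟫-*ₚ 1ₚ p φ) (trans (ℤP.+-identityʳ _) (trans (ℤP.*-identityˡ _)
    (⟪⟫-cong p (λ f → cong φ (⊞-identityˡ f)))))

*ₚ-zeroʳ : ∀ p → p *ₚ 0ₚ ≅ 0ₚ
*ₚ-zeroʳ p = ≅-intro λ φ → trans (⟪⟫-*ₚ p [] φ) (⟪⟫-zero p)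

^ₚ-cong : ∀ n {u v} → u ≅ v → u ^ₚ n ≅ v ^ₚ n
^ₚ-cong zero    u≅v = ≅-refl
^ₚ-cong (suc n) u≅v = *ₚ-cong u≅v (^ₚ-cong n u≅v)

indicator : Mono → Mono → ℤ
indicator m e = if does (≡-dec ℤ._≟_ e m) then + 1 else + 0

coeff-⟪⟫ : ∀ p m → coeff p m ≡ ⟪ p ⟫ (indicator m)
coeff-⟪⟫ [] m = refl
coeff-⟪⟫ ((c , e) ∷ p) m with does (≡-dec ℤ._≟_ e m)
... | true  = cong₂ _+_ (sym (ℤP.*-identityʳ c)) (coeff-⟪⟫ p m)
... | false = trans (coeff-⟪⟫ p m)
                (sym (trans (cong (_+ ⟪ p ⟫ (indicator m)) (ℤP.*-zeroʳ c)) (ℤP.+-identityˡ _)))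

≅⇒≈ₚ : ∀ {p q} → p ≅ q → p ≈ₚ q
≅⇒≈ₚ {p} {q} p≅q m = trans (coeff-⟪⟫ p m) (trans (p≅q on indicator m) (sym (coeff-⟪⟫ q m)))

-- Checking identities between concrete Laurent polynomials

lexLess : ∀ {n} → Vec ℤ n → Vec ℤ n → Bool
lexLess [] [] = false
lexLess (a ∷ as) (b ∷ bs) =
  if does (a ℤ.<? b) then true else (if does (a ℤ.≟ b) then lexLess as bs else false)

insert : Term → LPoly → LPoly
insert t [] = t ∷ []
insert (c , e) ((d , f) ∷ p) =
  if does (≡-dec ℤ._≟_ e f) then (c + d , f) ∷ p
  else (if lexLess e f then (c , e) ∷ (d , f) ∷ p else (d , f) ∷ insert (c , e) p)

⟪⟫-insert : ∀ c e p φ → ⟪ insert (c , e) p ⟫ φ ≡ c * φ e + ⟪ p ⟫ φ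
⟪⟫-insert c e [] φ = refl
⟪⟫-insert c e ((d , f) ∷ p) φ with ≡-dec ℤ._≟_ e f
... | yes refl = merge c d (φ e) (⟪ p ⟫ φ)
  where
  merge : ∀ c d a r → (c + d) * a + r ≡ c * a + (d * a + r)
  merge = solve-∀
... | no _ with lexLess e f
...   | true  = refl
...   | false = trans (cong (_+_ (d * φ f)) (⟪⟫-insert c e p φ)) (swap c d (φ e) (φ f) (⟪ p ⟫ φ))
  where
  swap : ∀ c d a b r → d * b + (c * a + r) ≡ c * a + (d * b + r)
  swap = solve-∀

sortMerge : LPoly → LPoly
sortMerge [] = []
sortMerge ((c , e) ∷ p) = insert (c , e) (sortMerge p)

dropZeros : LPoly → LPoly
dropZeros [] = []
dropZeros ((c , e) ∷ p) = if does (c ℤ.≟ + 0) then dropZeros p else (c , e) ∷ dropZeros p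

normalise : LPoly → LPoly
normalise p = dropZeros (sortMerge p)

⟪⟫-normalise : ∀ p φ → ⟪ normalise p ⟫ φ ≡ ⟪ p ⟫ φ
⟪⟫-normalise p φ = trans (⟪⟫-dropZeros (sortMerge p)) (⟪⟫-sortMerge p)
  where
  ⟪⟫-dropZeros : ∀ p → ⟪ dropZeros p ⟫ φ ≡ ⟪ p ⟫ φ
  ⟪⟫-dropZeros [] = refl
  ⟪⟫-dropZeros ((c , e) ∷ p) with c ℤ.≟ + 0
  ... | yes refl = trans (⟪⟫-dropZeros p) (sym (ℤP.+-identityˡ _))
  ... | no _     = cong (_+_ (c * φ e)) (⟪⟫-dropZeros p)
  ⟪⟫-sortMerge : ∀ p → ⟪ sortMerge p ⟫ φ ≡ ⟪ p ⟫ φ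
  ⟪⟫-sortMerge [] = refl
  ⟪⟫-sortMerge ((c , e) ∷ p) =
    trans (⟪⟫-insert c e (sortMerge p) φ) (cong (_+_ (c * φ e)) (⟪⟫-sortMerge p))

≅-by-normalise : ∀ {p q} → normalise p ≡ normalise q → p ≅ q
≅-by-normalise {p} {q} eq = ≅-intro λ φ →
  trans (sym (⟪⟫-normalise p φ)) (trans (cong (λ r → ⟪ r ⟫ φ) eq) (⟪⟫-normalise q φ))

-- The transpose, acting on weights, of the derivation sending a monomial to the sum over the
-- rules (i , d) of its i-th exponent times the monomial shifted by d (see ⟪⟫-D).
derivᵗ : List (Fin 5 × Mono) → (Mono → ℤ) → Mono → ℤ
derivᵗ [] φ e = + 0
derivᵗ ((i , d) ∷ rs) φ e = lookup e i * φ (e ⊞ d) + derivᵗ rs φ e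

rules : List (Fin 5 × Mono)
rules = (# 0 , + 0 ∷ + 0 ∷ + 0 ∷ + 0 ∷ + 1 ∷ [])
      ∷ (# 1 , + 0 ∷ -[1+ 0 ] ∷ + 1 ∷ + 1 ∷ + 0 ∷ [])
      ∷ (# 2 , + 0 ∷ + 0 ∷ + 0 ∷ + 1 ∷ + 0 ∷ [])
      ∷ (# 3 , + 0 ∷ + 0 ∷ + 1 ∷ + 0 ∷ + 0 ∷ [])
      ∷ (# 4 , + 0 ∷ + 0 ∷ + 1 ∷ + 1 ∷ -[1+ 0 ] ∷ [])
      ∷ []

Dᵗ : (Mono → ℤ) → Mono → ℤ
Dᵗ = derivᵗ rules

⟪⟫-D : ∀ p φ → ⟪ D p ⟫ φ ≡ ⟪ p ⟫ (Dᵗ φ)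
⟪⟫-D [] φ = refl
⟪⟫-D ((c , e@(i ∷ j ∷ k ∷ l ∷ m ∷ [])) ∷ p) φ =
  trans (⟪⟫-++ (DTerm (c , e)) (D p) φ) (cong₂ _+_ (factor c i j k l m _ _ _ _ _) (⟪⟫-D p φ))
  where
  factor : ∀ c i j k l m a₁ a₂ a₃ a₄ a₅ →
    (c * i) * a₁ + ((c * j) * a₂ + ((c * k) * a₃ + ((c * l) * a₄ + ((c * m) * a₅ + + 0))))
    ≡ c * (i * a₁ + (j * a₂ + (k * a₃ + (l * a₄ + (m * a₅ + + 0)))))
  factor = solve-∀

derivᵗ-⊞ : ∀ rs φ e f →
           derivᵗ rs φ (e ⊞ f) ≡ derivᵗ rs (λ v → φ (v ⊞ f)) e + derivᵗ rs (λ v → φ (e ⊞ v)) f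
derivᵗ-⊞ [] φ e f = refl
derivᵗ-⊞ ((i , d) ∷ rs) φ e f = begin
    lookup (e ⊞ f) i * φ ((e ⊞ f) ⊞ d) + derivᵗ rs φ (e ⊞ f)
  ≡⟨ cong₂ _+_ (cong (_* φ ((e ⊞ f) ⊞ d)) (lookup-zipWith ℤ._+_ i e f)) (derivᵗ-⊞ rs φ e f) ⟩
    (lookup e i + lookup f i) * φ ((e ⊞ f) ⊞ d) + (L + R)
  ≡⟨ split (lookup e i) (lookup f i) (φ ((e ⊞ f) ⊞ d)) L R ⟩
    (lookup e i * φ ((e ⊞ f) ⊞ d) + L) + (lookup f i * φ ((e ⊞ f) ⊞ d) + R)
  ≡⟨ cong₂ (λ s t → (lookup e i * φ s + L) + (lookup f i * φ t + R)) e-first (⊞-assoc e f d) ⟩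
    (lookup e i * φ ((e ⊞ d) ⊞ f) + L) + (lookup f i * φ (e ⊞ (f ⊞ d)) + R)
  ∎
  where
  open ≡-Reasoning
  L R : ℤ
  L = derivᵗ rs (λ v → φ (v ⊞ f)) e
  R = derivᵗ rs (λ v → φ (e ⊞ v)) f
  split : ∀ a b x l r → (a + b) * x + (l + r) ≡ (a * x + l) + (b * x + r)
  split = solve-∀
  e-first : (e ⊞ f) ⊞ d ≡ (e ⊞ d) ⊞ f
  e-first = trans (⊞-assoc e f d) (trans (cong (e ⊞_) (⊞-comm f d)) (sym (⊞-assoc e d f)))

⟪⟫-derivᵗ : ∀ rs q e (Φ : Mono → Mono → ℤ) →
            ⟪ q ⟫ (λ f → derivᵗ rs (λ v → Φ v f) e) ≡ derivᵗ rs (λ v → ⟪ q ⟫ (Φ v)) e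
⟪⟫-derivᵗ [] q e Φ = ⟪⟫-zero q
⟪⟫-derivᵗ ((i , d) ∷ rs) q e Φ =
  trans (⟪⟫-+ q (λ f → lookup e i * Φ (e ⊞ d) f) (λ f → derivᵗ rs (λ v → Φ v f) e))
    (cong₂ _+_ (⟪⟫-*ˡ q (lookup e i) (Φ (e ⊞ d))) (⟪⟫-derivᵗ rs q e Φ))

D-cong : ∀ {p q} → p ≅ q → D p ≅ D q
D-cong {p} {q} p≅q = ≅-intro λ φ → trans (⟪⟫-D p φ) (trans (p≅q on _) (sym (⟪⟫-D q φ)))

D-++ : ∀ p q → D (p ++ q) ≅ D p ++ D q
D-++ p q = ≅-intro λ φ → begin
    ⟪ D (p ++ q) ⟫ φ                ≡⟨ trans (⟪⟫-D (p ++ q) φ) (⟪⟫-++ p q _) ⟩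
    ⟪ p ⟫ (Dᵗ φ) + ⟪ q ⟫ (Dᵗ φ)     ≡⟨ cong₂ _+_ (⟪⟫-D p φ) (⟪⟫-D q φ) ⟨
    ⟪ D p ⟫ φ + ⟪ D q ⟫ φ           ≡⟨ ⟪⟫-++ (D p) (D q) φ ⟨
    ⟪ D p ++ D q ⟫ φ                ∎
  where open ≡-Reasoning

D-leibniz : ∀ p q → D (p *ₚ q) ≅ D p *ₚ q ++ p *ₚ D q
D-leibniz p q = ≅-intro pairing
  where
  open ≡-Reasoning
  split : ∀ φ e → ⟪ q ⟫ (λ f → Dᵗ φ (e ⊞ f))
                ≡ Dᵗ (λ v → ⟪ q ⟫ (λ f → φ (v ⊞ f))) e + ⟪ D q ⟫ (λ f → φ (e ⊞ f))
  split φ e = begin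
      ⟪ q ⟫ (λ f → Dᵗ φ (e ⊞ f))
    ≡⟨ ⟪⟫-cong q (derivᵗ-⊞ rules φ e) ⟩
      ⟪ q ⟫ (λ f → Dᵗ (λ v → φ (v ⊞ f)) e + Dᵗ (λ v → φ (e ⊞ v)) f)
    ≡⟨ ⟪⟫-+ q _ _ ⟩
      ⟪ q ⟫ (λ f → Dᵗ (λ v → φ (v ⊞ f)) e) + ⟪ q ⟫ (Dᵗ (λ v → φ (e ⊞ v)))
    ≡⟨ cong₂ _+_ (⟪⟫-derivᵗ rules q e (λ v f → φ (v ⊞ f))) (sym (⟪⟫-D q _)) ⟩
      Dᵗ (λ v → ⟪ q ⟫ (λ f → φ (v ⊞ f))) e + ⟪ D q ⟫ (λ f → φ (e ⊞ f))
    ∎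
  pairing : ∀ φ → ⟪ D (p *ₚ q) ⟫ φ ≡ ⟪ D p *ₚ q ++ p *ₚ D q ⟫ φ
  pairing φ = begin
      ⟪ D (p *ₚ q) ⟫ φ
    ≡⟨ trans (⟪⟫-D (p *ₚ q) φ) (⟪⟫-*ₚ p q (Dᵗ φ)) ⟩
      ⟪ p ⟫ (λ e → ⟪ q ⟫ (λ f → Dᵗ φ (e ⊞ f)))
    ≡⟨ trans (⟪⟫-cong p (split φ)) (⟪⟫-+ p _ _) ⟩
      ⟪ p ⟫ (Dᵗ (λ e → ⟪ q ⟫ (λ f → φ (e ⊞ f)))) + ⟪ p ⟫ (λ e → ⟪ D q ⟫ (λ f → φ (e ⊞ f)))
    ≡⟨ cong (_+ ⟪ p ⟫ (λ e → ⟪ D q ⟫ (λ f → φ (e ⊞ f)))) (⟪⟫-D p _) ⟨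
      ⟪ D p ⟫ (λ e → ⟪ q ⟫ (λ f → φ (e ⊞ f))) + ⟪ p ⟫ (λ e → ⟪ D q ⟫ (λ f → φ (e ⊞ f)))
    ≡⟨ cong₂ _+_ (⟪⟫-*ₚ (D p) q φ) (⟪⟫-*ₚ p (D q) φ) ⟨
      ⟪ D p *ₚ q ⟫ φ + ⟪ p *ₚ D q ⟫ φ
    ≡⟨ ⟪⟫-++ (D p *ₚ q) (p *ₚ D q) φ ⟨
      ⟪ D p *ₚ q ++ p *ₚ D q ⟫ φ
    ∎

∑ : ℕ → (ℕ → ℤ) → ℤ
∑ zero    F = + 0
∑ (suc n) F = F 0 + ∑ n (λ k → F (suc k))

∑-cong< : ∀ n {F G} → (∀ k → k ℕ.< n → F k ≡ G k) → ∑ n F ≡ ∑ n G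
∑-cong< zero    F≗G = refl
∑-cong< (suc n) F≗G = cong₂ _+_ (F≗G 0 (s≤s ℕ.z≤n)) (∑-cong< n (λ k k<n → F≗G (suc k) (s≤s k<n)))

∑-cong : ∀ n {F G} → (∀ k → F k ≡ G k) → ∑ n F ≡ ∑ n G
∑-cong n F≗G = ∑-cong< n (λ k _ → F≗G k)

∑-vanishing : ∀ n {F} → (∀ k → k ℕ.< n → F k ≡ + 0) → ∑ n F ≡ + 0
∑-vanishing n F≗0 = trans (∑-cong< n F≗0) (∑-zero n)
  where
  ∑-zero : ∀ n → ∑ n (λ _ → + 0) ≡ + 0
  ∑-zero zero    = refl
  ∑-zero (suc n) = trans (ℤP.+-identityˡ _) (∑-zero n)

∑-+ : ∀ n F G → ∑ n (λ k → F k + G k) ≡ ∑ n F + ∑ n G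
∑-+ zero    F G = refl
∑-+ (suc n) F G =
  trans (cong (_+_ (F 0 + G 0)) (∑-+ n (λ k → F (suc k)) (λ k → G (suc k)))) (swap (F 0) (G 0) _ _)
  where
  swap : ∀ a b c d → (a + b) + (c + d) ≡ (a + c) + (b + d)
  swap = solve-∀

∑-*ˡ : ∀ n c F → ∑ n (λ k → c * F k) ≡ c * ∑ n F
∑-*ˡ zero    c F = sym (ℤP.*-zeroʳ c)
∑-*ˡ (suc n) c F =
  trans (cong (_+_ (c * F 0)) (∑-*ˡ n c (λ k → F (suc k)))) (sym (ℤP.*-distribˡ-+ c (F 0) _))

∑-last : ∀ n F → ∑ (suc n) F ≡ ∑ n F + F n
∑-last zero    F = ℤP.+-comm (F 0) (+ 0)
∑-last (suc n) F = trans (cong (_+_ (F 0)) (∑-last n (λ k → F (suc k)))) (sym (ℤP.+-assoc (F 0) _ _))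

-- The n-th coefficient of a product in divided-power coordinates.
binomialSum : ℕ → (ℕ → ℕ → ℤ) → ℤ
binomialSum n h = ∑ (suc n) (λ k → + (n C k) * h k (n ∸ k))

binomialSum-cong : ∀ n {h h′} → (∀ i j → h i j ≡ h′ i j) → binomialSum n h ≡ binomialSum n h′
binomialSum-cong n h≗h′ = ∑-cong (suc n) (λ k → cong (+ (n C k) *_) (h≗h′ k (n ∸ k)))

binomialSum-+ : ∀ n g h → binomialSum n (λ i j → g i j + h i j) ≡ binomialSum n g + binomialSum n h
binomialSum-+ n g h =
  trans (∑-cong (suc n) (λ k → ℤP.*-distribˡ-+ (+ (n C k)) (g k (n ∸ k)) (h k (n ∸ k))))
    (∑-+ (suc n) (λ k → + (n C k) * g k (n ∸ k)) (λ k → + (n C k) * h k (n ∸ k)))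

binomialSum-*ˡ : ∀ n c h → binomialSum n (λ i j → c * h i j) ≡ c * binomialSum n h
binomialSum-*ˡ n c h =
  trans (∑-cong (suc n) (λ k → swap (+ (n C k)) c (h k (n ∸ k))))
    (∑-*ˡ (suc n) c (λ k → + (n C k) * h k (n ∸ k)))
  where
  swap : ∀ a c x → a * (c * x) ≡ c * (a * x)
  swap = solve-∀

-- Pascal's rule C(n+1,k+1) = C(n,k) + C(n,k+1), summed: the Leibniz rule in coefficients.
binomialSum-suc : ∀ n h → binomialSum (suc n) h
                          ≡ binomialSum n (λ i j → h (suc i) j) + binomialSum n (λ i j → h i (suc j))
binomialSum-suc n h = begin
    + 1 * h 0 (suc n) + ∑ (suc n) (λ k → + (suc n C suc k) * h (suc k) (n ∸ k))
  ≡⟨ cong (_+_ (+ 1 * h 0 (suc n))) (trans (∑-cong (suc n) pascal) (∑-+ (suc n) lower upper)) ⟩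
    + 1 * h 0 (suc n) + (B₁ + ∑ (suc n) upper)
  ≡⟨ cong (λ t → + 1 * h 0 (suc n) + (B₁ + t)) (trans (∑-last n upper) (cong₂ _+_ reindex top)) ⟩
    + 1 * h 0 (suc n) + (B₁ + (B₂-tail + + 0 * h (suc n) (n ∸ n)))
  ≡⟨ rearrange (h 0 (suc n)) B₁ B₂-tail (h (suc n) (n ∸ n)) ⟩
    B₁ + (+ 1 * h 0 (suc n) + B₂-tail)
  ∎
  where
  open ≡-Reasoning
  lower upper : ℕ → ℤ
  lower k = + (n C k) * h (suc k) (n ∸ k)
  upper k = + (n C suc k) * h (suc k) (n ∸ k)
  B₁ B₂-tail : ℤ
  B₁      = binomialSum n (λ i j → h (suc i) j)
  B₂-tail = ∑ n (λ k → + (n C suc k) * h (suc k) (suc (n ∸ suc k)))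
  pascal : ∀ k → + (suc n C suc k) * h (suc k) (n ∸ k) ≡ lower k + upper k
  pascal k = trans (cong (λ c → + c * h (suc k) (n ∸ k)) (sym (nCk+nC[k+1]≡[n+1]C[k+1] n k)))
                   (ℤP.*-distribʳ-+ _ (+ (n C k)) (+ (n C suc k)))
  ∸-suc : ∀ n k → k ℕ.< n → n ∸ k ≡ suc (n ∸ suc k)
  ∸-suc (suc n) zero    _         = refl
  ∸-suc (suc n) (suc k) (s≤s k<n) = ∸-suc n k k<n
  reindex : ∑ n upper ≡ B₂-tail
  reindex = ∑-cong< n (λ k k<n → cong (λ t → + (n C suc k) * h (suc k) t) (∸-suc n k k<n))
  top : upper n ≡ + 0 * h (suc n) (n ∸ n)
  top = cong (λ c → + c * h (suc n) (n ∸ n)) (k>n⇒nCk≡0 (ℕP.n<1+n n))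
  rearrange : ∀ a x y b → + 1 * a + (x + (y + + 0 * b)) ≡ x + (+ 1 * a + y)
  rearrange = solve-∀

-- The ring of exponential power series

infix 4 _≋_
record _≋_ (f g : Series) : Set where
  constructor ≋-intro
  infixl 21 _at_
  field _at_ : ∀ n → f n ≅ g n
open _≋_ public

≋-refl : ∀ {f} → f ≋ f
≋-refl = ≋-intro λ _ → ≅-refl

≋-sym : ∀ {f g} → f ≋ g → g ≋ f
≋-sym e = ≋-intro λ n → ≅-sym (e at n)

≋-trans : ∀ {f g h} → f ≋ g → g ≋ h → f ≋ h
≋-trans e e′ = ≋-intro λ n → ≅-trans (e at n) (e′ at n)

≋-setoid : Setoid _ _
≋-setoid = record
  { Carrier = Series ; _≈_ = _≋_
  ; isEquivalence = record { refl = ≋-refl ; sym = ≋-sym ; trans = ≋-trans } }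

module ≋-Reasoning = SetoidReasoning ≋-setoid

≋⇒≈ₛ : ∀ {f g} → f ≋ g → f ≈ₛ g
≋⇒≈ₛ f≋g n = ≅⇒≈ₚ (f≋g at n)

∂ : Series → Series
∂ f n = f (suc n)

0S 1S : Series
0S _ = 0ₚ
1S = const 1ₚ

negS : Series → Series
negS f n = negₚ (f n)

⟪⟫-concatMap-applyUpTo : ∀ (H : ℕ → LPoly) f n φ →
                         ⟪ concatMap H (applyUpTo f n) ⟫ φ ≡ ∑ n (λ k → ⟪ H (f k) ⟫ φ)
⟪⟫-concatMap-applyUpTo H f zero    φ = refl
⟪⟫-concatMap-applyUpTo H f (suc n) φ =
  trans (⟪⟫-++ (H (f 0)) _ φ) (cong (_+_ (⟪ H (f 0) ⟫ φ)) (⟪⟫-concatMap-applyUpTo H (λ k → f (suc k)) n φ))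

⟪⟫-⊛ : ∀ f g n φ → ⟪ (f ⊛ g) n ⟫ φ ≡ binomialSum n (λ i j → ⟪ f i *ₚ g j ⟫ φ)
⟪⟫-⊛ f g n φ =
  trans (⟪⟫-concatMap-applyUpTo (λ k → scaleₚ (+ (n C k)) (f k *ₚ g (n ∸ k))) (λ k → k) (suc n) φ)
  (∑-cong (suc n) (λ k → ⟪⟫-scaleₚ (+ (n C k)) (f k *ₚ g (n ∸ k)) φ))

⊕-cong : ∀ {f f′ g g′} → f ≋ f′ → g ≋ g′ → f ⊕ g ≋ f′ ⊕ g′
⊕-cong f≋f′ g≋g′ = ≋-intro λ n → ++-cong (f≋f′ at n) (g≋g′ at n)

⊛-cong : ∀ {f f′ g g′} → f ≋ f′ → g ≋ g′ → f ⊛ g ≋ f′ ⊛ g′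
⊛-cong {f} {f′} {g} {g′} f≋f′ g≋g′ = ≋-intro λ n → ≅-intro λ φ → begin
    ⟪ (f ⊛ g) n ⟫ φ
  ≡⟨ ⟪⟫-⊛ f g n φ ⟩
    binomialSum n (λ i j → ⟪ f i *ₚ g j ⟫ φ)
  ≡⟨ binomialSum-cong n (λ i j → *ₚ-cong (f≋f′ at i) (g≋g′ at j) on φ) ⟩
    binomialSum n (λ i j → ⟪ f′ i *ₚ g′ j ⟫ φ)
  ≡⟨ ⟪⟫-⊛ f′ g′ n φ ⟨
    ⟪ (f′ ⊛ g′) n ⟫ φ
  ∎
  where open ≡-Reasoning

⊕-congˡ : ∀ f {g g′} → g ≋ g′ → f ⊕ g ≋ f ⊕ g′
⊕-congˡ f = ⊕-cong (≋-refl {f})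

⊕-congʳ : ∀ h {f f′} → f ≋ f′ → f ⊕ h ≋ f′ ⊕ h
⊕-congʳ h f≋f′ = ⊕-cong f≋f′ (≋-refl {h})

⊛-congˡ : ∀ f {g g′} → g ≋ g′ → f ⊛ g ≋ f ⊛ g′
⊛-congˡ f = ⊛-cong (≋-refl {f})

⊛-congʳ : ∀ h {f f′} → f ≋ f′ → f ⊛ h ≋ f′ ⊛ h
⊛-congʳ h f≋f′ = ⊛-cong f≋f′ (≋-refl {h})

⊛-distribʳ : ∀ h f g → (f ⊕ g) ⊛ h ≋ f ⊛ h ⊕ g ⊛ h
⊛-distribʳ h f g = ≋-intro λ n → ≅-intro λ φ → begin
    ⟪ ((f ⊕ g) ⊛ h) n ⟫ φ
  ≡⟨ ⟪⟫-⊛ (f ⊕ g) h n φ ⟩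
    binomialSum n (λ i j → ⟪ (f i ++ g i) *ₚ h j ⟫ φ)
  ≡⟨ binomialSum-cong n (λ i j →
       trans (*ₚ-distribʳ (f i) (g i) (h j) on φ) (⟪⟫-++ (f i *ₚ h j) (g i *ₚ h j) φ)) ⟩
    binomialSum n (λ i j → ⟪ f i *ₚ h j ⟫ φ + ⟪ g i *ₚ h j ⟫ φ)
  ≡⟨ binomialSum-+ n (λ i j → ⟪ f i *ₚ h j ⟫ φ) (λ i j → ⟪ g i *ₚ h j ⟫ φ) ⟩
    binomialSum n (λ i j → ⟪ f i *ₚ h j ⟫ φ) + binomialSum n (λ i j → ⟪ g i *ₚ h j ⟫ φ)
  ≡⟨ cong₂ _+_ (⟪⟫-⊛ f h n φ) (⟪⟫-⊛ g h n φ) ⟨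
    ⟪ (f ⊛ h) n ⟫ φ + ⟪ (g ⊛ h) n ⟫ φ
  ≡⟨ ⟪⟫-++ ((f ⊛ h) n) ((g ⊛ h) n) φ ⟨
    ⟪ (f ⊛ h ⊕ g ⊛ h) n ⟫ φ
  ∎
  where open ≡-Reasoning

∂-⊛ : ∀ f g → ∂ (f ⊛ g) ≋ ∂ f ⊛ g ⊕ f ⊛ ∂ g
∂-⊛ f g = ≋-intro λ n → ≅-intro λ φ → begin
    ⟪ (f ⊛ g) (suc n) ⟫ φ
  ≡⟨ trans (⟪⟫-⊛ f g (suc n) φ) (binomialSum-suc n (λ i j → ⟪ f i *ₚ g j ⟫ φ)) ⟩
    binomialSum n (λ i j → ⟪ f (suc i) *ₚ g j ⟫ φ) + binomialSum n (λ i j → ⟪ f i *ₚ g (suc j) ⟫ φ)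
  ≡⟨ cong₂ _+_ (⟪⟫-⊛ (∂ f) g n φ) (⟪⟫-⊛ f (∂ g) n φ) ⟨
    ⟪ (∂ f ⊛ g) n ⟫ φ + ⟪ (f ⊛ ∂ g) n ⟫ φ
  ≡⟨ ⟪⟫-++ ((∂ f ⊛ g) n) ((f ⊛ ∂ g) n) φ ⟨
    ⟪ (∂ f ⊛ g ⊕ f ⊛ ∂ g) n ⟫ φ
  ∎
  where open ≡-Reasoning

⊛-at-0 : ∀ f g → (f ⊛ g) 0 ≅ f 0 *ₚ g 0
⊛-at-0 f g = ≅-intro λ φ → trans (⟪⟫-⊛ f g 0 φ) (trans (ℤP.+-identityʳ _) (ℤP.*-identityˡ _))

-- Commutativity and associativity are proved coefficientwise by induction on n: the 0-th
-- coefficient is a product in LPoly, and the Leibniz rule ∂-⊛ reduces coefficient n + 1 to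
-- coefficient n of products of derivatives.
⊛-comm : ∀ f g → f ⊛ g ≋ g ⊛ f
⊛-comm f g = ≋-intro λ n → comm n f g
  where
  open ≅-Reasoning
  comm : ∀ n f g → (f ⊛ g) n ≅ (g ⊛ f) n
  comm zero f g = begin
      (f ⊛ g) 0     ≈⟨ ⊛-at-0 f g ⟩
      f 0 *ₚ g 0    ≈⟨ *ₚ-comm (f 0) (g 0) ⟩
      g 0 *ₚ f 0    ≈⟨ ⊛-at-0 g f ⟨
      (g ⊛ f) 0     ∎
  comm (suc n) f g = begin
      (f ⊛ g) (suc n)                 ≈⟨ ∂-⊛ f g at n ⟩
      (∂ f ⊛ g) n ++ (f ⊛ ∂ g) n      ≈⟨ ++-cong (comm n (∂ f) g) (comm n f (∂ g)) ⟩
      (g ⊛ ∂ f) n ++ (∂ g ⊛ f) n      ≈⟨ ++-comm ((g ⊛ ∂ f) n) ((∂ g ⊛ f) n) ⟩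
      (∂ g ⊛ f) n ++ (g ⊛ ∂ f) n      ≈⟨ ∂-⊛ g f at n ⟨
      (g ⊛ f) (suc n)                 ∎

⊛-distribˡ : ∀ f g h → f ⊛ (g ⊕ h) ≋ f ⊛ g ⊕ f ⊛ h
⊛-distribˡ f g h = begin
    f ⊛ (g ⊕ h)        ≈⟨ ⊛-comm f (g ⊕ h) ⟩
    (g ⊕ h) ⊛ f        ≈⟨ ⊛-distribʳ f g h ⟩
    g ⊛ f ⊕ h ⊛ f      ≈⟨ ⊕-cong (⊛-comm g f) (⊛-comm h f) ⟩
    f ⊛ g ⊕ f ⊛ h      ∎
  where open ≋-Reasoning

⊛-assoc : ∀ f g h → (f ⊛ g) ⊛ h ≋ f ⊛ (g ⊛ h)
⊛-assoc f g h = ≋-intro λ n → assoc n f g h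
  where
  open ≅-Reasoning
  assoc : ∀ n f g h → ((f ⊛ g) ⊛ h) n ≅ (f ⊛ (g ⊛ h)) n
  assoc zero f g h = begin
      ((f ⊛ g) ⊛ h) 0            ≈⟨ ⊛-at-0 (f ⊛ g) h ⟩
      (f ⊛ g) 0 *ₚ h 0           ≈⟨ *ₚ-cong (⊛-at-0 f g) (≅-refl {h 0}) ⟩
      (f 0 *ₚ g 0) *ₚ h 0        ≈⟨ *ₚ-assoc (f 0) (g 0) (h 0) ⟩
      f 0 *ₚ (g 0 *ₚ h 0)        ≈⟨ *ₚ-cong (≅-refl {f 0}) (⊛-at-0 g h) ⟨
      f 0 *ₚ (g ⊛ h) 0           ≈⟨ ⊛-at-0 f (g ⊛ h) ⟨
      (f ⊛ (g ⊛ h)) 0            ∎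
  assoc (suc n) f g h = begin
      ((f ⊛ g) ⊛ h) (suc n)
    ≈⟨ ∂-⊛ (f ⊛ g) h at n ⟩
      (∂ (f ⊛ g) ⊛ h) n ++ ((f ⊛ g) ⊛ ∂ h) n
    ≈⟨ ++-cong (expandˡ at n) (≅-refl {((f ⊛ g) ⊛ ∂ h) n}) ⟩
      (((∂ f ⊛ g) ⊛ h) n ++ ((f ⊛ ∂ g) ⊛ h) n) ++ ((f ⊛ g) ⊛ ∂ h) n
    ≈⟨ ++-cong (++-cong (assoc n (∂ f) g h) (assoc n f (∂ g) h)) (assoc n f g (∂ h)) ⟩
      ((∂ f ⊛ (g ⊛ h)) n ++ (f ⊛ (∂ g ⊛ h)) n) ++ (f ⊛ (g ⊛ ∂ h)) n
    ≈⟨ ≅-reflexive (++-assoc ((∂ f ⊛ (g ⊛ h)) n) _ _) ⟩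
      (∂ f ⊛ (g ⊛ h)) n ++ ((f ⊛ (∂ g ⊛ h)) n ++ (f ⊛ (g ⊛ ∂ h)) n)
    ≈⟨ ++-cong (≅-refl {(∂ f ⊛ (g ⊛ h)) n}) (expandʳ at n) ⟨
      (∂ f ⊛ (g ⊛ h)) n ++ (f ⊛ ∂ (g ⊛ h)) n
    ≈⟨ ∂-⊛ f (g ⊛ h) at n ⟨
      (f ⊛ (g ⊛ h)) (suc n)
    ∎
    where
    expandˡ : ∂ (f ⊛ g) ⊛ h ≋ (∂ f ⊛ g) ⊛ h ⊕ (f ⊛ ∂ g) ⊛ h
    expandˡ = ≋-trans (⊛-congʳ h (∂-⊛ f g)) (⊛-distribʳ h (∂ f ⊛ g) (f ⊛ ∂ g))
    expandʳ : f ⊛ ∂ (g ⊛ h) ≋ f ⊛ (∂ g ⊛ h) ⊕ f ⊛ (g ⊛ ∂ h)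
    expandʳ = ≋-trans (⊛-congˡ f (∂-⊛ g h)) (⊛-distribˡ f (∂ g ⊛ h) (g ⊛ ∂ h))

const-⊛ : ∀ p f n → (const p ⊛ f) n ≅ p *ₚ f n
const-⊛ p f n = ≅-intro λ φ → begin
    ⟪ (const p ⊛ f) n ⟫ φ
  ≡⟨ ⟪⟫-⊛ (const p) f n φ ⟩
    + 1 * ⟪ p *ₚ f n ⟫ φ + ∑ n (λ k → + (n C suc k) * + 0)
  ≡⟨ cong (_+_ (+ 1 * ⟪ p *ₚ f n ⟫ φ)) (∑-vanishing n (λ k _ → ℤP.*-zeroʳ (+ (n C suc k)))) ⟩
    + 1 * ⟪ p *ₚ f n ⟫ φ + + 0
  ≡⟨ trans (ℤP.+-identityʳ _) (ℤP.*-identityˡ _) ⟩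
    ⟪ p *ₚ f n ⟫ φ
  ∎
  where open ≡-Reasoning

⊛-identityˡ : ∀ f → 1S ⊛ f ≋ f
⊛-identityˡ f = ≋-intro λ n → ≅-trans (const-⊛ 1ₚ f n) (*ₚ-identityˡ (f n))

⊛-vanishing : ∀ f g n → (∀ i → i ℕ.≤ n → f i ≅ 0ₚ) → (f ⊛ g) n ≅ 0ₚ
⊛-vanishing f g n f≅0 = ≅-intro λ φ → trans (⟪⟫-⊛ f g n φ) (∑-vanishing (suc n) λ k k<1+n →
  trans (cong (+ (n C k) *_) (*ₚ-cong (f≅0 k (ℕP.≤-pred k<1+n)) (≅-refl {g (n ∸ k)}) on φ))
        (ℤP.*-zeroʳ (+ (n C k))))

⊛-zeroˡ : ∀ f → 0S ⊛ f ≋ 0S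
⊛-zeroˡ f = ≋-intro λ n → ⊛-vanishing 0S f n (λ _ _ → ≅-refl)

negS-cong : ∀ {f g} → f ≋ g → negS f ≋ negS g
negS-cong {f} {g} f≋g = ≋-intro λ n → ≅-intro λ φ →
  trans (⟪⟫-scaleₚ (- + 1) (f n) φ)
    (trans (cong (- + 1 *_) (f≋g at n on φ)) (sym (⟪⟫-scaleₚ (- + 1) (g n) φ)))

negS-⊛ : ∀ f g → negS f ⊛ g ≋ negS (f ⊛ g)
negS-⊛ f g = ≋-intro λ n → ≅-intro λ φ → begin
    ⟪ (negS f ⊛ g) n ⟫ φ
  ≡⟨ ⟪⟫-⊛ (negS f) g n φ ⟩
    binomialSum n (λ i j → ⟪ negₚ (f i) *ₚ g j ⟫ φ)
  ≡⟨ binomialSum-cong n (λ i j → negₚ-*ₚ (f i) (g j) φ) ⟩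
    binomialSum n (λ i j → - + 1 * ⟪ f i *ₚ g j ⟫ φ)
  ≡⟨ binomialSum-*ˡ n (- + 1) (λ i j → ⟪ f i *ₚ g j ⟫ φ) ⟩
    - + 1 * binomialSum n (λ i j → ⟪ f i *ₚ g j ⟫ φ)
  ≡⟨ cong (- + 1 *_) (⟪⟫-⊛ f g n φ) ⟨
    - + 1 * ⟪ (f ⊛ g) n ⟫ φ
  ≡⟨ ⟪⟫-scaleₚ (- + 1) ((f ⊛ g) n) φ ⟨
    ⟪ negₚ ((f ⊛ g) n) ⟫ φ
  ∎
  where
  open ≡-Reasoning
  negₚ-*ₚ : ∀ p q φ → ⟪ negₚ p *ₚ q ⟫ φ ≡ - + 1 * ⟪ p *ₚ q ⟫ φ
  negₚ-*ₚ p q φ = trans (⟪⟫-*ₚ (negₚ p) q φ)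
    (trans (⟪⟫-scaleₚ (- + 1) p _) (cong (- + 1 *_) (sym (⟪⟫-*ₚ p q φ))))

negS-⊕ : ∀ f g → negS f ⊕ negS g ≋ negS (f ⊕ g)
negS-⊕ f g = ≋-intro λ n → ≅-intro λ φ → begin
    ⟪ negₚ (f n) ++ negₚ (g n) ⟫ φ
  ≡⟨ trans (⟪⟫-++ (negₚ (f n)) _ φ)
       (cong₂ _+_ (⟪⟫-scaleₚ (- + 1) (f n) φ) (⟪⟫-scaleₚ (- + 1) (g n) φ)) ⟩
    - + 1 * ⟪ f n ⟫ φ + - + 1 * ⟪ g n ⟫ φ
  ≡⟨ ℤP.*-distribˡ-+ (- + 1) (⟪ f n ⟫ φ) (⟪ g n ⟫ φ) ⟨
    - + 1 * (⟪ f n ⟫ φ + ⟪ g n ⟫ φ)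
  ≡⟨ trans (⟪⟫-scaleₚ (- + 1) (f n ++ g n) φ) (cong (- + 1 *_) (⟪⟫-++ (f n) (g n) φ)) ⟨
    ⟪ negₚ (f n ++ g n) ⟫ φ
  ∎
  where open ≡-Reasoning

open Biased _≋_ using (module IsCommutativeSemiringˡ; module IsCommutativeMonoidˡ)

SeriesRing : AlmostCommutativeRing _ _
SeriesRing = record
  { Carrier = Series
  ; _≈_ = _≋_
  ; _+_ = _⊕_
  ; _*_ = _⊛_
  ; -_ = negS
  ; 0# = 0S
  ; 1# = 1S
  ; isAlmostCommutativeRing = record
    { isCommutativeSemiring = IsCommutativeSemiringˡ.isCommutativeSemiring record
      { +-isCommutativeMonoid = IsCommutativeMonoidˡ.isCommutativeMonoid record
        { isSemigroup = record
          { isMagma = record { isEquivalence = Setoid.isEquivalence ≋-setoid ; ∙-cong = ⊕-cong }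
          ; assoc = λ f g h → ≋-intro λ n → ≅-reflexive (++-assoc (f n) (g n) (h n)) }
        ; identityˡ = λ f → ≋-refl
        ; comm = λ f g → ≋-intro λ n → ++-comm (f n) (g n) }
      ; *-isCommutativeMonoid = IsCommutativeMonoidˡ.isCommutativeMonoid record
        { isSemigroup = record
          { isMagma = record { isEquivalence = Setoid.isEquivalence ≋-setoid ; ∙-cong = ⊛-cong }
          ; assoc = ⊛-assoc }
        ; identityˡ = ⊛-identityˡ
        ; comm = ⊛-comm }
      ; distribʳ = ⊛-distribʳ
      ; zeroˡ = ⊛-zeroˡ }
    ; -‿cong = negS-cong
    ; -‿*-distribˡ = negS-⊛
    ; -‿+-comm = negS-⊕ } }

ι : ℤ → Series
ι k = const ((k , 0ᵐ) ∷ [])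

ι-homomorphism : ℤ.+-*-rawRing -Raw-AlmostCommutative⟶ SeriesRing
ι-homomorphism = record
  { ⟦_⟧    = ι
  ; +-homo = λ a b → ≋-intro λ
      { zero    → ≅-intro λ φ → distrib a b (φ 0ᵐ)
      ; (suc n) → ≅-refl }
  ; *-homo = λ a b → ≋-intro λ
      { zero    → ≅-sym (const-⊛ ((a , 0ᵐ) ∷ []) (ι b) 0)
      ; (suc n) → ≅-sym (≅-trans (const-⊛ ((a , 0ᵐ) ∷ []) (ι b) (suc n)) (*ₚ-zeroʳ ((a , 0ᵐ) ∷ []))) }
  ; -‿homo = λ a → ≋-intro λ
      { zero    → ≅-intro λ φ → cong (λ c → c * φ 0ᵐ + + 0) (sym (ℤP.-1*i≡-i a))
      ; (suc n) → ≅-refl }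
  ; 0-homo = ≋-intro λ
      { zero    → ≅-intro λ φ → cong (_+ + 0) (ℤP.*-zeroˡ (φ 0ᵐ))
      ; (suc n) → ≅-refl }
  ; 1-homo = ≋-refl
  }
  where
  distrib : ∀ a b x → (a + b) * x + + 0 ≡ a * x + (b * x + + 0)
  distrib = solve-∀

ι-dec : ∀ a b → Maybe (ι a ≋ ι b)
ι-dec a b with a ℤ.≟ b
... | yes refl = just ≋-refl
... | no _     = nothing

-- f ⊖ g unfolds to f ⊕ negS g, so the solver's _:-_ also covers ⊖.
open import Algebra.Solver.Ring ℤ.+-*-rawRing SeriesRing ι-homomorphism ι-dec
  using (solve; _:=_; _:+_; _:*_; _:-_; :-_; con)

⊖-0S : ∀ f → f ⊖ 0S ≋ f
⊖-0S f = ≋-intro λ n → ≅-reflexive (++-identityʳ (f n))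

linear-ode-uniqueness : ∀ {W} K → ∂ W ≋ W ⊛ K → W 0 ≅ 0ₚ → W ≋ 0S
linear-ode-uniqueness {W} K ∂W≋WK W₀≅0 = ≋-intro λ n → vanishes-below (suc n) n ℕP.≤-refl
  where
  vanishes-below : ∀ n k → k ℕ.< n → W k ≅ 0ₚ
  vanishes-below (suc n) zero    _         = W₀≅0
  vanishes-below (suc n) (suc k) (s≤s k<n) = ≅-trans (∂W≋WK at k)
    (⊛-vanishing W K k (λ i i≤k → vanishes-below n i (ℕP.≤-<-trans i≤k k<n)))

≋-from-linear-ode : ∀ {f g} K → ∂ (f ⊖ g) ≋ (f ⊖ g) ⊛ K → (f ⊖ g) 0 ≅ 0ₚ → f ≋ g
≋-from-linear-ode {f} {g} K ∂W≋WK W₀≅0 = begin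
    f              ≈⟨ solve 2 (λ f g → f := (f :- g) :+ g) ≋-refl f g ⟩
    (f ⊖ g) ⊕ g    ≈⟨ ⊕-congʳ g (linear-ode-uniqueness K ∂W≋WK W₀≅0) ⟩
    g              ∎
  where open ≋-Reasoning

const-cong : ∀ {p q} → p ≅ q → const p ≋ const q
const-cong p≅q = ≋-intro λ { zero → p≅q ; (suc n) → ≅-refl }

const-+ₚ : ∀ p q → const (p +ₚ q) ≋ const p ⊕ const q
const-+ₚ p q = ≋-intro λ { zero → ≅-refl ; (suc n) → ≅-refl }

const-⊖ : ∀ p q → const (p -ₚ q) ≋ const p ⊖ const q
const-⊖ p q = ≋-intro λ { zero → ≅-refl ; (suc n) → ≅-refl }

const-*ₚ : ∀ p q → const (p *ₚ q) ≋ const p ⊛ const q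
const-*ₚ p q = ≋-intro λ
  { zero    → ≅-sym (const-⊛ p (const q) 0)
  ; (suc n) → ≅-sym (≅-trans (const-⊛ p (const q) (suc n)) (*ₚ-zeroʳ p)) }

∂-const-⊛ : ∀ p f → ∂ (const p ⊛ f) ≋ const p ⊛ ∂ f
∂-const-⊛ p f = ≋-intro λ n → ≅-trans (const-⊛ p f (suc n)) (≅-sym (const-⊛ p (∂ f) n))

∂-expS : ∀ u → ∂ (expS u) ≋ const u ⊛ expS u
∂-expS u = ≋-intro λ n → ≅-sym (const-⊛ u (expS u) n)

∂-const-⊛-expS : ∀ p u → ∂ (const p ⊛ expS u) ≋ const p ⊛ (const u ⊛ expS u)
∂-const-⊛-expS p u = ≋-trans (∂-const-⊛ p (expS u)) (⊛-congˡ (const p) (∂-expS u))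

expS-cong : ∀ {u v} → u ≅ v → expS u ≋ expS v
expS-cong u≅v = ≋-intro λ n → ^ₚ-cong n u≅v

expS-+ₚ : ∀ u v → expS u ⊛ expS v ≋ expS (u +ₚ v)
expS-+ₚ u v = ≋-from-linear-ode (Cu ⊕ Cv) ∂W (≅-by-normalise refl)
  where
  open ≋-Reasoning
  Eu Ev Euv Cu Cv : Series
  Eu = expS u
  Ev = expS v
  Euv = expS (u +ₚ v)
  Cu = const u
  Cv = const v
  ∂W : ∂ (Eu ⊛ Ev ⊖ Euv) ≋ (Eu ⊛ Ev ⊖ Euv) ⊛ (Cu ⊕ Cv)
  ∂W = begin
      ∂ (Eu ⊛ Ev) ⊖ ∂ Euv
    ≈⟨ ⊕-cong (∂-⊛ Eu Ev) (negS-cong (≋-trans (∂-expS (u +ₚ v)) (⊛-congʳ Euv (const-+ₚ u v)))) ⟩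
      (∂ Eu ⊛ Ev ⊕ Eu ⊛ ∂ Ev) ⊖ (Cu ⊕ Cv) ⊛ Euv
    ≈⟨ ⊕-congʳ (negS ((Cu ⊕ Cv) ⊛ Euv)) (⊕-cong (⊛-congʳ Ev (∂-expS u)) (⊛-congˡ Eu (∂-expS v))) ⟩
      (Cu ⊛ Eu ⊛ Ev ⊕ Eu ⊛ (Cv ⊛ Ev)) ⊖ (Cu ⊕ Cv) ⊛ Euv
    ≈⟨ solve 5 (λ eu ev euv cu cv →
                 (cu :* eu :* ev :+ eu :* (cv :* ev)) :- (cu :+ cv) :* euv
                 := (eu :* ev :- euv) :* (cu :+ cv))
               ≋-refl Eu Ev Euv Cu Cv ⟩
      (Eu ⊛ Ev ⊖ Euv) ⊛ (Cu ⊕ Cv)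
    ∎

-- The exponential generating function of D

D^-comm : ∀ n w → D^ n (D w) ≡ D (D^ n w)
D^-comm zero    w = refl
D^-comm (suc n) w = cong D (D^-comm n w)

D^-cong : ∀ n {p q} → p ≅ q → D^ n p ≅ D^ n q
D^-cong zero    p≅q = p≅q
D^-cong (suc n) p≅q = D-cong (D^-cong n p≅q)

D^-++ : ∀ n p q → D^ n (p ++ q) ≅ D^ n p ++ D^ n q
D^-++ zero    p q = ≅-refl
D^-++ (suc n) p q = ≅-trans (D-cong (D^-++ n p q)) (D-++ (D^ n p) (D^ n q))

D^-0ₚ : ∀ n → D^ n 0ₚ ≡ 0ₚ
D^-0ₚ zero    = refl
D^-0ₚ (suc n) = cong D (D^-0ₚ n)

∂-Gen : ∀ w → ∂ (Gen w) ≋ Gen (D w)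
∂-Gen w = ≋-intro λ n → ≅-reflexive (sym (D^-comm n w))

Gen-cong : ∀ {p q} → p ≅ q → Gen p ≋ Gen q
Gen-cong p≅q = ≋-intro λ n → D^-cong n p≅q

Gen-+ₚ : ∀ p q → Gen (p +ₚ q) ≋ Gen p ⊕ Gen q
Gen-+ₚ p q = ≋-intro λ n → D^-++ n p q

Gen-const : ∀ {w} → D w ≅ 0ₚ → Gen w ≋ const w
Gen-const {w} Dw≅0 = ≋-intro λ
  { zero    → ≅-refl
  ; (suc n) → ≅-trans (≅-reflexive (sym (D^-comm n w)))
                      (≅-trans (D^-cong n Dw≅0) (≅-reflexive (D^-0ₚ n))) }

Gen-*ₚ : ∀ u v → Gen (u *ₚ v) ≋ Gen u ⊛ Gen v
Gen-*ₚ u v = ≋-intro λ n → multiplicative n u v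
  where
  open ≅-Reasoning
  multiplicative : ∀ n u v → D^ n (u *ₚ v) ≅ (Gen u ⊛ Gen v) n
  multiplicative zero    u v = ≅-sym (⊛-at-0 (Gen u) (Gen v))
  multiplicative (suc n) u v = begin
      D (D^ n (u *ₚ v))
    ≈⟨ ≅-reflexive (sym (D^-comm n (u *ₚ v))) ⟩
      D^ n (D (u *ₚ v))
    ≈⟨ ≅-trans (D^-cong n (D-leibniz u v)) (D^-++ n (D u *ₚ v) (u *ₚ D v)) ⟩
      D^ n (D u *ₚ v) ++ D^ n (u *ₚ D v)
    ≈⟨ ++-cong (multiplicative n (D u) v) (multiplicative n u (D v)) ⟩
      (Gen (D u) ⊛ Gen v) n ++ (Gen u ⊛ Gen (D v)) n
    ≈⟨ ⊕-cong (⊛-congʳ (Gen v) (∂-Gen u)) (⊛-congˡ (Gen u) (∂-Gen v)) at n ⟨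
      (∂ (Gen u) ⊛ Gen v) n ++ (Gen u ⊛ ∂ (Gen v)) n
    ≈⟨ ∂-⊛ (Gen u) (Gen v) at n ⟨
      (Gen u ⊛ Gen v) (suc n)
    ∎

Gen-by-constant-difference : ∀ {v w} → D (w -ₚ v) ≅ 0ₚ → Gen w ≋ Gen v ⊕ (const w ⊖ const v)
Gen-by-constant-difference {v} {w} D[w-v]≅0 = begin
    Gen w                      ≈⟨ Gen-cong (≅-sym (+ₚ-minus v w)) ⟩
    Gen (v +ₚ (w -ₚ v))        ≈⟨ Gen-+ₚ v (w -ₚ v) ⟩
    Gen v ⊕ Gen (w -ₚ v)       ≈⟨ ⊕-congˡ (Gen v) (≋-trans (Gen-const D[w-v]≅0) (const-⊖ w v)) ⟩
    Gen v ⊕ (const w ⊖ const v) ∎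
  where open ≋-Reasoning

∂-Gen-eigen : ∀ {u v} → D v ≅ v *ₚ u → ∂ (Gen v) ≋ Gen v ⊛ Gen u
∂-Gen-eigen {u} {v} Dv≅vu = ≋-trans (∂-Gen v) (≋-trans (Gen-cong Dv≅vu) (Gen-*ₚ v u))

X A Cx Cy Cz Cb Cy/x Ca[y-x] Ex Ey Ez Ex-y R T : Series
X = Gen vx
A = Gen va
Cx = const vx
Cy = const vy
Cz = const vz
Cb = const vb
Cy/x = const (vy *ₚ x⁻¹)
Ca[y-x] = const (va *ₚ (vy -ₚ vx))
Ex = expS vx
Ey = expS vy
Ez = expS vz
Ex-y = expS (vx -ₚ vy)
R = 1S ⊖ Cy/x ⊛ Ex-y
T = Cy ⊛ Ex ⊖ Cx ⊛ Ey

Gen-vy : Gen vy ≋ X ⊕ (Cy ⊖ Cx)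
Gen-vy = Gen-by-constant-difference (≅-by-normalise refl)

Gen-vz : Gen vz ≋ X ⊕ (Cz ⊖ Cx)
Gen-vz = Gen-by-constant-difference (≅-by-normalise refl)

Gen-vb : Gen vb ≋ X ⊕ (Cb ⊖ Cx)
Gen-vb = Gen-by-constant-difference (≅-by-normalise refl)

X-riccati : ∂ X ≋ X ⊛ (X ⊕ (Cy ⊖ Cx))
X-riccati = ≋-trans (∂-Gen-eigen (≅-by-normalise refl)) (⊛-congˡ X Gen-vy)

A-ode : ∂ A ≋ A ⊛ (X ⊕ (Cz ⊖ Cx))
A-ode = ≋-trans (∂-Gen-eigen (≅-by-normalise refl)) (⊛-congˡ A Gen-vz)

R-ode : ∂ R ≋ (Cx ⊖ Cy) ⊛ (R ⊖ 1S)
R-ode = begin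
    ∂ R
  ≡⟨⟩
    negS (∂ (Cy/x ⊛ Ex-y))
  ≈⟨ negS-cong (∂-const-⊛-expS (vy *ₚ x⁻¹) (vx -ₚ vy)) ⟩
    negS (Cy/x ⊛ (const (vx -ₚ vy) ⊛ Ex-y))
  ≈⟨ negS-cong (⊛-congˡ Cy/x (⊛-congʳ Ex-y (const-⊖ vx vy))) ⟩
    negS (Cy/x ⊛ ((Cx ⊖ Cy) ⊛ Ex-y))
  ≈⟨ solve 4 (λ cx cy r e → :- (r :* ((cx :- cy) :* e))
                            := (cx :- cy) :* ((con (+ 1) :- r :* e) :- con (+ 1)))
             ≋-refl Cx Cy Cy/x Ex-y ⟩
    (Cx ⊖ Cy) ⊛ (R ⊖ 1S)
  ∎
  where open ≋-Reasoning

X⊛R : X ⊛ R ≋ Cx ⊖ Cy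
X⊛R = ≋-from-linear-ode X ∂W (≅-by-normalise refl)
  where
  open ≋-Reasoning
  ∂W : ∂ (X ⊛ R ⊖ (Cx ⊖ Cy)) ≋ (X ⊛ R ⊖ (Cx ⊖ Cy)) ⊛ X
  ∂W = begin
      ∂ (X ⊛ R ⊖ (Cx ⊖ Cy))
    ≡⟨⟩
      ∂ (X ⊛ R) ⊖ 0S
    ≈⟨ ≋-trans (⊖-0S (∂ (X ⊛ R))) (∂-⊛ X R) ⟩
      ∂ X ⊛ R ⊕ X ⊛ ∂ R
    ≈⟨ ⊕-cong (⊛-congʳ R X-riccati) (⊛-congˡ X R-ode) ⟩
      X ⊛ (X ⊕ (Cy ⊖ Cx)) ⊛ R ⊕ X ⊛ ((Cx ⊖ Cy) ⊛ (R ⊖ 1S))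
    ≈⟨ solve 4 (λ x cx cy r → x :* (x :+ (cy :- cx)) :* r :+ x :* ((cx :- cy) :* (r :- con (+ 1)))
                              := (x :* r :- (cx :- cy)) :* x)
               ≋-refl X Cx Cy R ⟩
      (X ⊛ R ⊖ (Cx ⊖ Cy)) ⊛ X
    ∎

T-factorisation : T ≋ negS (Cx ⊛ Ey ⊛ R)
T-factorisation = begin
    Cy ⊛ Ex ⊖ Cx ⊛ Ey
  ≈⟨ ⊕-congʳ (negS (Cx ⊛ Ey)) (⊛-cong Cy≋Cx⊛Cy/x Ex≋Ey⊛Ex-y) ⟩
    (Cx ⊛ Cy/x) ⊛ (Ey ⊛ Ex-y) ⊖ Cx ⊛ Ey
  ≈⟨ solve 4 (λ cx r ey e → (cx :* r) :* (ey :* e) :- cx :* ey := :- (cx :* ey :* (con (+ 1) :- r :* e)))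
             ≋-refl Cx Cy/x Ey Ex-y ⟩
    negS (Cx ⊛ Ey ⊛ R)
  ∎
  where
  open ≋-Reasoning
  Cy≋Cx⊛Cy/x : Cy ≋ Cx ⊛ Cy/x
  Cy≋Cx⊛Cy/x = ≋-trans (const-cong (≅-by-normalise refl)) (const-*ₚ vx (vy *ₚ x⁻¹))
  Ex≋Ey⊛Ex-y : Ex ≋ Ey ⊛ Ex-y
  Ex≋Ey⊛Ex-y = ≋-trans (expS-cong (≅-sym (+ₚ-minus vy vx))) (≋-sym (expS-+ₚ vy (vx -ₚ vy)))

X⊛T : X ⊛ T ≋ negS (Cx ⊛ Ey ⊛ (Cx ⊖ Cy))
X⊛T = begin
    X ⊛ T
  ≈⟨ ⊛-congˡ X T-factorisation ⟩
    X ⊛ negS (Cx ⊛ Ey ⊛ R)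
  ≈⟨ solve 4 (λ x cx ey r → x :* (:- (cx :* ey :* r)) := :- (cx :* ey :* (x :* r))) ≋-refl X Cx Ey R ⟩
    negS (Cx ⊛ Ey ⊛ (X ⊛ R))
  ≈⟨ negS-cong (⊛-congˡ (Cx ⊛ Ey) X⊛R) ⟩
    negS (Cx ⊛ Ey ⊛ (Cx ⊖ Cy))
  ∎
  where open ≋-Reasoning

T-ode : ∂ T ≋ (Cx ⊖ X) ⊛ T
T-ode = begin
    ∂ T
  ≡⟨⟩
    ∂ (Cy ⊛ Ex) ⊖ ∂ (Cx ⊛ Ey)
  ≈⟨ ⊕-cong (∂-const-⊛-expS vy vx) (negS-cong (∂-const-⊛-expS vx vy)) ⟩
    Cy ⊛ (Cx ⊛ Ex) ⊖ Cx ⊛ (Cy ⊛ Ey)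
  ≈⟨ solve 4 (λ cx cy ex ey → cy :* (cx :* ex) :- cx :* (cy :* ey)
                              := cx :* (cy :* ex :- cx :* ey) :- (:- (cx :* ey :* (cx :- cy))))
             ≋-refl Cx Cy Ex Ey ⟩
    Cx ⊛ T ⊖ negS (Cx ⊛ Ey ⊛ (Cx ⊖ Cy))
  ≈⟨ ⊕-congˡ (Cx ⊛ T) (negS-cong (≋-sym X⊛T)) ⟩
    Cx ⊛ T ⊖ X ⊛ T
  ≈⟨ solve 3 (λ cx x t → cx :* t :- x :* t := (cx :- x) :* t) ≋-refl Cx X T ⟩
    (Cx ⊖ X) ⊛ T
  ∎
  where open ≋-Reasoning

A⊛T : A ⊛ T ≋ Ca[y-x] ⊛ Ez
A⊛T = ≋-from-linear-ode Cz ∂W (≅-by-normalise refl)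
  where
  open ≋-Reasoning
  ∂W : ∂ (A ⊛ T ⊖ Ca[y-x] ⊛ Ez) ≋ (A ⊛ T ⊖ Ca[y-x] ⊛ Ez) ⊛ Cz
  ∂W = begin
      ∂ (A ⊛ T) ⊖ ∂ (Ca[y-x] ⊛ Ez)
    ≈⟨ ⊕-cong (∂-⊛ A T) (negS-cong (∂-const-⊛-expS (va *ₚ (vy -ₚ vx)) vz)) ⟩
      (∂ A ⊛ T ⊕ A ⊛ ∂ T) ⊖ Ca[y-x] ⊛ (Cz ⊛ Ez)
    ≈⟨ ⊕-congʳ (negS (Ca[y-x] ⊛ (Cz ⊛ Ez))) (⊕-cong (⊛-congʳ T A-ode) (⊛-congˡ A T-ode)) ⟩
      (A ⊛ (X ⊕ (Cz ⊖ Cx)) ⊛ T ⊕ A ⊛ ((Cx ⊖ X) ⊛ T)) ⊖ Ca[y-x] ⊛ (Cz ⊛ Ez)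
    ≈⟨ solve 7 (λ a x cx cz t c ez →
                 (a :* (x :+ (cz :- cx)) :* t :+ a :* ((cx :- x) :* t)) :- c :* (cz :* ez)
                 := (a :* t :- c :* ez) :* cz)
               ≋-refl A X Cx Cz T Ca[y-x] Ez ⟩
      (A ⊛ T ⊖ Ca[y-x] ⊛ Ez) ⊛ Cz
    ∎

theorem3p7 : Gen (va *ₚ vb)
    ⊛ (const vy ⊛ expS vx ⊖ const vx ⊛ expS vy)
    ⊛ (const 1ₚ ⊖ const (vy *ₚ x⁻¹) ⊛ expS (vx -ₚ vy))
    ≈ₛ const (va *ₚ (vy -ₚ vx)) ⊛ expS vz
    ⊛ (const (vx -ₚ vy)
    ⊕ const (vb -ₚ vx) ⊛ (const 1ₚ ⊖ const (vy *ₚ x⁻¹) ⊛ expS (vx -ₚ vy)))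
theorem3p7 = ≋⇒≈ₛ (begin
    Gen (va *ₚ vb) ⊛ T ⊛ R
  ≈⟨ ⊛-congʳ R (⊛-congʳ T (≋-trans (Gen-*ₚ va vb) (⊛-congˡ A Gen-vb))) ⟩
    A ⊛ (X ⊕ (Cb ⊖ Cx)) ⊛ T ⊛ R
  ≈⟨ solve 5 (λ a x c t r → a :* (x :+ c) :* t :* r := (a :* t) :* (x :* r :+ c :* r))
             ≋-refl A X (Cb ⊖ Cx) T R ⟩
    (A ⊛ T) ⊛ (X ⊛ R ⊕ (Cb ⊖ Cx) ⊛ R)
  ≈⟨ ⊛-cong A⊛T (⊕-congʳ ((Cb ⊖ Cx) ⊛ R) X⊛R) ⟩
    Ca[y-x] ⊛ Ez ⊛ ((Cx ⊖ Cy) ⊕ (Cb ⊖ Cx) ⊛ R)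
  ≈⟨ ⊛-congˡ (Ca[y-x] ⊛ Ez) (⊕-cong (const-⊖ vx vy) (⊛-congʳ R (const-⊖ vb vx))) ⟨
    Ca[y-x] ⊛ Ez ⊛ (const (vx -ₚ vy) ⊕ const (vb -ₚ vx) ⊛ R)
  ∎)
  where open ≋-Reasoning
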